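{- Let $H(X,Y,E)$ be a complete bipartite $3$-uniform hypergraph with $|X|=|Y|=k$, where $k$ is even. Then the edge-domatic number of $H$ is $ed(H)=\dfrac{|E|}{k/2}$.
   Context: A hypergraph has a finite vertex set and a set of hyperedges, each a subset of the vertex set; it is $3$-uniform if every hyperedge has exactly $3$ vertices. A complete bipartite $3$-uniform hypergraph $H(X,Y,E)$ has vertex set $X\cup Y$ with $X,Y$ disjoint and nonempty, and its hyperedges are all $3$-element subsets of $X\cup Y$ containing at least one vertex of $X$ and at least one vertex of $Y$. Two distinct hyperedges are adjacent if they share at least one vertex. An edge-dominating set is a subset $E_d\subseteq E$ such that every hyperedge in $E\setminus E_d$ is adjacent to some hyperedge in $E_d$. The edge-domatic number $ed(H)$ is the maximum number of classes in a partition of $E$ into edge-dominating sets. -}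

module Defs where

open import Data.Nat using (ℕ; zero; suc; _+_; _≡ᵇ_; _≤_)
open import Data.Bool using (Bool; true; false; T; _∧_; _∨_; if_then_else_)
open import Data.Vec using (Vec; []; _∷_; lookup)
open import Data.Fin using (Fin)
open import Data.Sum using (_⊎_; inj₁; inj₂)
open import Data.Product using (Σ; _×_; ∃; _,_; proj₁)
open import Relation.Binary.PropositionalEquality using (_≡_)
open import Relation.Nullary using (¬_)
open import Function.Definitions using (Surjective)

ones : ∀ {n} → Vec Bool n → ℕ
ones []           = 0
ones (true  ∷ v)  = suc (ones v)
ones (false ∷ v)  = ones v

anyB : ∀ {n} → Vec Bool n → Bool
anyB []      = false
anyB (b ∷ v) = b ∨ anyB v

Vertex : ℕ → Set
Vertex k = Fin k ⊎ Fin k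

VSubset : ℕ → Set
VSubset k = Vec Bool k × Vec Bool k

_∈V_ : ∀ {k} → Vertex k → VSubset k → Set
inj₁ x ∈V (sX , sY) = lookup sX x ≡ true
inj₂ y ∈V (sX , sY) = lookup sY y ≡ true

isEdge : ∀ {k} → VSubset k → Bool
isEdge (sX , sY) = ((ones sX + ones sY) ≡ᵇ 3) ∧ anyB sX ∧ anyB sY

-- The hyperedge set E (T is proof-irrelevant, so edges are exactly these subsets).
Edge : ℕ → Set
Edge k = Σ (VSubset k) (λ s → T (isEdge s))

Adjacent : ∀ {k} → Edge k → Edge k → Set
Adjacent e f = ¬ (e ≡ f) × ∃ (λ v → (v ∈V proj₁ e) × (v ∈V proj₁ f))

IsEdgeDominating : ∀ {k} → (Edge k → Set) → Set
IsEdgeDominating {k} D = (e : Edge k) → ¬ D e → ∃ (λ f → D f × Adjacent e f)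

-- A partition of E into m (nonempty) classes, each an edge-dominating set.
-- A partition is encoded by the class-assignment map c : E → Fin m (surjective).
EdgeDomaticPartition : (k m : ℕ) → Set
EdgeDomaticPartition k m =
  Σ (Edge k → Fin m) (λ c →
     Surjective _≡_ _≡_ c × ((i : Fin m) → IsEdgeDominating (λ e → c e ≡ i)))

EdgeDomaticNumber : (k m : ℕ) → Set
EdgeDomaticNumber k m =
  EdgeDomaticPartition k m × ((m' : ℕ) → EdgeDomaticPartition k m' → m' ≤ m)

-- Write k = 2h and n = k − 1. An edge-dominating set has at least h edges: fewer than h edges
-- cover at most k − 2 vertices on each side, so some edge meets none of them, and that edge or an
-- edge dominating it is one more member of the set. Hence ed(H) · h ≤ |E|.
-- Conversely, colour the pairs of vertices of each side by the round-robin 1-factorisation of K_k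
-- with n colours. For a side s, a colour r and a vertex y of the other side, the edges consisting
-- of a pair of colour r on s together with y form an edge-dominating set, because every colour
-- class covers every vertex. These 2nk classes partition E, and |E| = 2 · C(k,2) · k = 2nk · h.

module Submission where

open import Defs
open import Data.Nat using (ℕ; _*_; _/_; NonZero)
open import Data.Fin using (Fin)
open import Function.Bundles using (_↔_)
open import Relation.Binary.PropositionalEquality using (_≡_)

open import Data.Bool using (Bool; true; false; T; if_then_else_)
open import Data.Bool.Properties using (T-irrelevant; ¬-not)
open import Data.Fin using (zero; suc; toℕ; fromℕ; fromℕ<; inject₁; _≟_)
open import Data.Fin.Properties
  using ( toℕ-injective; toℕ-fromℕ; toℕ-fromℕ<; toℕ-inject₁; toℕ<n; fromℕ≢inject₁; inject₁-injective
        ; injective⇒≤; +↔⊎; *↔×)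
import Data.Fin.Properties as Fin
open import Data.Fin.Relation.Unary.Top using (view; ‵fromℕ; ‵inject₁)
open import Data.Fin.Subset using (⁅_⁆; _∪_; ⋃) renaming (⊥ to ∅)
open import Data.Fin.Subset.Properties using (x∈⁅x⁆; x∈⁅y⁆⇒x≡y; x∈p∪q⁻; x∈p∪q⁺; ∪-identityˡ; ∪-comm)
open import Data.List using (tabulate)
open import Data.Nat
  using (zero; suc; _+_; _∸_; _≤_; _<_; _%_; _≡ᵇ_; z≤n; s≤s; s≤s⁻¹; >-nonZero⁻¹; ≢-nonZero⁻¹)
open import Data.Nat.Combinatorics using (_C_; nC1≡n; nCk+nC[k+1]≡[n+1]C[k+1])
open import Data.Nat.DivMod
  using ( _mod_; %-distribˡ-+; %-distribˡ-*; m%n%n≡m%n; [m+n]%n≡m%n; [m+kn]%n≡m%n; m<n⇒m%n≡m; m%n<n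
        ; m*n/n≡m)
open import Data.Nat.Properties
  using ( suc-injective; ≡ᵇ⇒≡; ≡-irrelevant; ≤-reflexive; ≤-trans; ≤-antisym; <⇒≤; n≤1+n; +-suc
        ; +-identityʳ; +-mono-≤; +-monoʳ-≤; *-monoʳ-≤; *-suc; *-distribˡ-+; *-cancelʳ-≤; m+[n∸m]≡n
        ; m+1+n≢0; m*n≢0; even≢odd)
open import Data.Nat.Tactic.RingSolver using (solve-∀)
open import Data.Product using (Σ; ∃; ∃₂; _×_; _,_; proj₁; proj₂)
open import Data.Product.Function.NonDependent.Propositional using (_×-↔_; _×-↣_)
open import Data.Sum using (_⊎_; inj₁; inj₂; [_,_]′)
import Data.Sum as Sum
open import Data.Sum.Function.Propositional using (_⊎-↣_)
open import Data.Sum.Properties using (inj₁-injective; inj₂-injective)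
open import Data.Unit using (tt)
open import Data.Vec using (Vec; []; _∷_; lookup)
open import Data.Vec.Properties using ([]=⇒lookup; lookup⇒[]=)
open import Function using (_∘_)
open import Function.Bundles using (Injection; Inverse; _↣_; mk↣)
open import Function.Definitions using (Injective; Surjective)
open import Function.Properties.Injection using (↣-trans)
open import Function.Properties.Inverse using (↔⇒↣; ↔-refl; ↔-sym; ↔-trans)
open import Relation.Binary.PropositionalEquality
  using (refl; sym; trans; cong; cong₂; subst; _≢_; module ≡-Reasoning)
open import Relation.Nullary using (¬_; yes; no; contradiction)
open import Relation.Unary using (Decidable)

private variable
  m j k : ℕ

m+[n+o]≡n+[m+o] : ∀ m n o → m + (n + o) ≡ n + (m + o)
m+[n+o]≡n+[m+o] = solve-∀

lookup-⁅⁆ : (a : Fin m) → lookup ⁅ a ⁆ a ≡ true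
lookup-⁅⁆ a = []=⇒lookup (x∈⁅x⁆ a)

lookup-⁅⁆⁻ : (a x : Fin m) → lookup ⁅ a ⁆ x ≡ true → x ≡ a
lookup-⁅⁆⁻ a x x∈a = x∈⁅y⁆⇒x≡y a (lookup⇒[]= x ⁅ a ⁆ x∈a)

lookup-⁅⁆-≢ : {a x : Fin m} → x ≢ a → lookup ⁅ a ⁆ x ≡ false
lookup-⁅⁆-≢ {a = a} {x} x≢a = ¬-not (x≢a ∘ lookup-⁅⁆⁻ a x)

lookup-∪⁺ : (p q : Vec Bool m) (x : Fin m) →
            lookup p x ≡ true ⊎ lookup q x ≡ true → lookup (p ∪ q) x ≡ true
lookup-∪⁺ p q x x∈ = []=⇒lookup (x∈p∪q⁺ (Sum.map (lookup⇒[]= x p) (lookup⇒[]= x q) x∈))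

lookup-∪⁻ : (p q : Vec Bool m) (x : Fin m) →
            lookup (p ∪ q) x ≡ true → lookup p x ≡ true ⊎ lookup q x ≡ true
lookup-∪⁻ p q x x∈ = Sum.map []=⇒lookup []=⇒lookup (x∈p∪q⁻ p q (lookup⇒[]= x (p ∪ q) x∈))

-- Prepending a coordinate shifts every element of the tail up by one.
elementSum : Vec Bool m → ℕ
elementSum []      = 0
elementSum (_ ∷ v) = ones v + elementSum v

ones-∅ : ∀ m → ones (∅ {m}) ≡ 0
ones-∅ zero    = refl
ones-∅ (suc m) = ones-∅ m

elementSum-∅ : ∀ m → elementSum (∅ {m}) ≡ 0
elementSum-∅ zero    = refl
elementSum-∅ (suc m) = cong₂ _+_ (ones-∅ m) (elementSum-∅ m)

ones-⁅⁆ : (a : Fin m) → ones ⁅ a ⁆ ≡ 1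
ones-⁅⁆ {suc m} zero = cong suc (ones-∅ m)
ones-⁅⁆ (suc a)      = ones-⁅⁆ a

elementSum-⁅⁆ : (a : Fin m) → elementSum ⁅ a ⁆ ≡ toℕ a
elementSum-⁅⁆ {suc m} zero = cong₂ _+_ (ones-∅ m) (elementSum-∅ m)
elementSum-⁅⁆ (suc a)      = cong₂ _+_ (ones-⁅⁆ a) (elementSum-⁅⁆ a)

ones-∪ : (p q : Vec Bool m) → ones (p ∪ q) ≤ ones p + ones q
ones-∪ []          []          = z≤n
ones-∪ (true ∷ p)  (true ∷ q)  = s≤s (≤-trans (ones-∪ p q) (+-monoʳ-≤ (ones p) (n≤1+n (ones q))))
ones-∪ (true ∷ p)  (false ∷ q) = s≤s (ones-∪ p q)
ones-∪ (false ∷ p) (true ∷ q)  = ≤-trans (s≤s (ones-∪ p q)) (≤-reflexive (sym (+-suc (ones p) (ones q))))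
ones-∪ (false ∷ p) (false ∷ q) = ones-∪ p q

ones-⁅⁆∪ : (a : Fin m) (p : Vec Bool m) → lookup p a ≡ false → ones (⁅ a ⁆ ∪ p) ≡ suc (ones p)
ones-⁅⁆∪ zero    (false ∷ p) _   = cong (suc ∘ ones) (∪-identityˡ p)
ones-⁅⁆∪ (suc a) (true ∷ p)  a∉p = cong suc (ones-⁅⁆∪ a p a∉p)
ones-⁅⁆∪ (suc a) (false ∷ p) a∉p = ones-⁅⁆∪ a p a∉p

elementSum-⁅⁆∪ : (a : Fin m) (p : Vec Bool m) → lookup p a ≡ false →
                 elementSum (⁅ a ⁆ ∪ p) ≡ toℕ a + elementSum p
elementSum-⁅⁆∪ zero    (false ∷ p) _   = cong (λ q → ones q + elementSum q) (∪-identityˡ p)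
elementSum-⁅⁆∪ (suc a) (b ∷ p)     a∉p = begin
  ones (⁅ a ⁆ ∪ p) + elementSum (⁅ a ⁆ ∪ p)
    ≡⟨ cong₂ _+_ (ones-⁅⁆∪ a p a∉p) (elementSum-⁅⁆∪ a p a∉p) ⟩
  suc (ones p) + (toℕ a + elementSum p)
    ≡⟨ cong suc (m+[n+o]≡n+[m+o] (ones p) (toℕ a) (elementSum p)) ⟩
  suc (toℕ a) + (ones p + elementSum p) ∎
  where open ≡-Reasoning

pair : Fin m → Fin m → Vec Bool m
pair a b = ⁅ a ⁆ ∪ ⁅ b ⁆

lookup-pairˡ : (a b : Fin m) → lookup (pair a b) a ≡ true
lookup-pairˡ a b = lookup-∪⁺ ⁅ a ⁆ ⁅ b ⁆ a (inj₁ (lookup-⁅⁆ a))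

lookup-pair⁻ : (a b x : Fin m) → lookup (pair a b) x ≡ true → x ≡ a ⊎ x ≡ b
lookup-pair⁻ a b x x∈ = Sum.map (lookup-⁅⁆⁻ a x) (lookup-⁅⁆⁻ b x) (lookup-∪⁻ ⁅ a ⁆ ⁅ b ⁆ x x∈)

lookup-pair-≢ : {a b x : Fin m} → x ≢ a → x ≢ b → lookup (pair a b) x ≡ false
lookup-pair-≢ {a = a} {b} {x} x≢a x≢b = ¬-not ([ x≢a , x≢b ]′ ∘ lookup-pair⁻ a b x)

ones-pair : {a b : Fin m} → a ≢ b → ones (pair a b) ≡ 2
ones-pair {a = a} {b} a≢b = trans (ones-⁅⁆∪ a ⁅ b ⁆ (lookup-⁅⁆-≢ a≢b)) (cong suc (ones-⁅⁆ b))

elementSum-pair : {a b : Fin m} → a ≢ b → elementSum (pair a b) ≡ toℕ a + toℕ b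
elementSum-pair {a = a} {b} a≢b =
  trans (elementSum-⁅⁆∪ a ⁅ b ⁆ (lookup-⁅⁆-≢ a≢b)) (cong (toℕ a +_) (elementSum-⁅⁆ b))

anyB⇒∃ : (v : Vec Bool m) → anyB v ≡ true → ∃ λ x → lookup v x ≡ true
anyB⇒∃ (true ∷ v)  _ = zero , refl
anyB⇒∃ (false ∷ v) p = let x , x∈v = anyB⇒∃ v p in suc x , x∈v

anyB⇒ones>0 : (v : Vec Bool m) → anyB v ≡ true → 0 < ones v
anyB⇒ones>0 (true ∷ v)  _ = s≤s z≤n
anyB⇒ones>0 (false ∷ v) p = anyB⇒ones>0 v p

ones≡suc⇒anyB : (v : Vec Bool m) → ones v ≡ suc j → anyB v ≡ true
ones≡suc⇒anyB (true ∷ v)  _ = refl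
ones≡suc⇒anyB (false ∷ v) p = ones≡suc⇒anyB v p

∃-∉ : (v : Vec Bool m) → ones v < m → ∃ λ a → lookup v a ≡ false
∃-∉ (true ∷ v)  p = let a , a∉v = ∃-∉ v (s≤s⁻¹ p) in suc a , a∉v
∃-∉ (false ∷ v) _ = zero , refl

∃₂-∉ : (v : Vec Bool m) → 2 + ones v ≤ m →
       ∃₂ λ a b → a ≢ b × lookup v a ≡ false × lookup v b ≡ false
∃₂-∉ (true ∷ v) p with ∃₂-∉ v (s≤s⁻¹ p)
... | a , b , a≢b , a∉v , b∉v = suc a , suc b , a≢b ∘ Fin.suc-injective , a∉v , b∉v
∃₂-∉ (false ∷ v) p with ∃-∉ v (s≤s⁻¹ p)
... | b , b∉v = zero , suc b , (λ ()) , refl , b∉v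

ones-⋃ : {c : ℕ} (f : Fin j → Vec Bool m) → (∀ i → ones (f i) ≤ c) → ones (⋃ (tabulate f)) ≤ j * c
ones-⋃ {zero}  {m} f _    = ≤-reflexive (ones-∅ m)
ones-⋃ {suc j}     f f≤c =
  ≤-trans (ones-∪ (f zero) _) (+-mono-≤ (f≤c zero) (ones-⋃ (f ∘ suc) (f≤c ∘ suc)))

lookup-⋃ : (f : Fin j → Vec Bool m) (i : Fin j) (x : Fin m) →
           lookup (f i) x ≡ true → lookup (⋃ (tabulate f)) x ≡ true
lookup-⋃ f zero    x x∈ = lookup-∪⁺ (f zero) _ x (inj₁ x∈)
lookup-⋃ f (suc i) x x∈ = lookup-∪⁺ (f zero) _ x (inj₂ (lookup-⋃ (f ∘ suc) i x x∈))

edgeX edgeY : Edge k → Vec Bool k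
edgeX e = proj₁ (proj₁ e)
edgeY e = proj₂ (proj₁ e)

isEdge⁻ : (sX sY : Vec Bool k) → T (isEdge (sX , sY)) →
          ones sX + ones sY ≡ 3 × anyB sX ≡ true × anyB sY ≡ true
isEdge⁻ sX sY t with ones sX + ones sY ≡ᵇ 3 in size | anyB sX in meetsX | anyB sY in meetsY
... | true | true | true = ≡ᵇ⇒≡ (ones sX + ones sY) 3 (subst T (sym size) tt) , refl , refl

isEdge⁺ : (sX sY : Vec Bool k) → ones sX + ones sY ≡ 3 → anyB sX ≡ true → anyB sY ≡ true →
          T (isEdge (sX , sY))
isEdge⁺ sX sY size meetsX meetsY rewrite size | meetsX | meetsY = tt

Edge-≡ : (e f : Edge k) → proj₁ e ≡ proj₁ f → e ≡ f
Edge-≡ (s , t) (.s , t′) refl = cong (s ,_) (T-irrelevant t t′)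

edge₂₁ : {a b : Fin k} → a ≢ b → Fin k → Edge k
edge₂₁ {a = a} {b} a≢b y = (pair a b , ⁅ y ⁆) ,
  isEdge⁺ (pair a b) ⁅ y ⁆ (cong₂ _+_ (ones-pair a≢b) (ones-⁅⁆ y))
          (ones≡suc⇒anyB (pair a b) (ones-pair a≢b)) (ones≡suc⇒anyB ⁅ y ⁆ (ones-⁅⁆ y))

edge₁₂ : {a b : Fin k} → Fin k → a ≢ b → Edge k
edge₁₂ {a = a} {b} y a≢b = (⁅ y ⁆ , pair a b) ,
  isEdge⁺ ⁅ y ⁆ (pair a b) (cong₂ _+_ (ones-⁅⁆ y) (ones-pair a≢b))
          (ones≡suc⇒anyB ⁅ y ⁆ (ones-⁅⁆ y)) (ones≡suc⇒anyB (pair a b) (ones-pair a≢b))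

Shape : ℕ → ℕ → Set
Shape a b = (a ≡ 2 × b ≡ 1) ⊎ (a ≡ 1 × b ≡ 2)

shape : {a b : ℕ} → a + b ≡ 3 → 0 < a → 0 < b → Shape a b
shape {1}                 {1}                 ()    _ _
shape {1}                 {2}                 refl  _ _ = inj₂ (refl , refl)
shape {1}                 {suc (suc (suc _))} ()    _ _
shape {2}                 {1}                 refl  _ _ = inj₁ (refl , refl)
shape {2}                 {suc (suc _)}       ()    _ _
shape {suc (suc (suc a))} {suc _}             a+b≡3 _ _ =
  contradiction (suc-injective (suc-injective (suc-injective a+b≡3))) (m+1+n≢0 a)

edge-shape : (e : Edge k) → Shape (ones (edgeX e)) (ones (edgeY e))
edge-shape ((sX , sY) , t) =
  let size , meetsX , meetsY = isEdge⁻ sX sY t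
  in shape size (anyB⇒ones>0 sX meetsX) (anyB⇒ones>0 sY meetsY)

edgeX≤2 : (e : Edge k) → ones (edgeX e) ≤ 2
edgeX≤2 e = [ (λ (x≡2 , _) → ≤-reflexive x≡2) , (λ (x≡1 , _) → ≤-trans (≤-reflexive x≡1) (n≤1+n 1)) ]′
              (edge-shape e)

edgeY≤2 : (e : Edge k) → ones (edgeY e) ≤ 2
edgeY≤2 e = [ (λ (_ , y≡1) → ≤-trans (≤-reflexive y≡1) (n≤1+n 1)) , (λ (_ , y≡2) → ≤-reflexive y≡2) ]′
              (edge-shape e)

-- Edge-dominating sets are large

Meet : Edge k → Edge k → Set
Meet e f = ∃ λ v → v ∈V proj₁ e × v ∈V proj₁ f

meet-self : (e : Edge k) → Meet e e
meet-self ((sX , sY) , t) =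
  let y , y∈sY = anyB⇒∃ sY (proj₂ (proj₂ (isEdge⁻ sX sY t))) in inj₂ y , y∈sY , y∈sY

covered : (Edge k → Vec Bool k) → (Fin j → Edge k) → Vec Bool k
covered side g = ⋃ (tabulate (side ∘ g))

room : (side : Edge k → Vec Bool k) → (∀ e → ones (side e) ≤ 2) →
       2 * suc j ≤ k → (g : Fin j → Edge k) → 2 + ones (covered side g) ≤ k
room {j = j} side side≤2 2j+2≤k g =
  ≤-trans (+-monoʳ-≤ 2 (ones-⋃ (side ∘ g) (side≤2 ∘ g))) (≤-trans (≤-reflexive (2+j*2≡2*[1+j] j)) 2j+2≤k)
  where
  2+j*2≡2*[1+j] : ∀ j → 2 + j * 2 ≡ 2 * suc j
  2+j*2≡2*[1+j] = solve-∀

∃-edge-avoiding : 2 * suc j ≤ k → (g : Fin j → Edge k) → ∃ λ e → ∀ i → ¬ Meet e (g i)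
∃-edge-avoiding {j} {k} 2j+2≤k g
  with ∃₂-∉ (covered edgeX g) (room edgeX edgeX≤2 2j+2≤k g)
     | ∃-∉ (covered edgeY g) (≤-trans (n≤1+n _) (room edgeY edgeY≤2 2j+2≤k g))
... | a , b , a≢b , a∉ , b∉ | y , y∉ = edge₂₁ a≢b y , avoids
  where
  free : (side : Edge k → Vec Bool k) (i : Fin j) (x z : Fin k) →
         lookup (covered side g) z ≡ false → lookup (side (g i)) x ≡ true → x ≢ z
  free side i x z z∉ x∈ refl with trans (sym (lookup-⋃ (side ∘ g) i x x∈)) z∉
  ... | ()
  avoids : ∀ i → ¬ Meet (edge₂₁ a≢b y) (g i)
  avoids i (inj₁ x , x∈ab , x∈gi) =
    [ free edgeX i x a a∉ x∈gi , free edgeX i x b b∉ x∈gi ]′ (lookup-pair⁻ a b x x∈ab)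
  avoids i (inj₂ x , x∈y  , x∈gi) = free edgeY i x y y∉ x∈gi (lookup-⁅⁆⁻ y x x∈y)

module _ {D : Edge k → Set} (D? : Decidable D) (dominating : IsEdgeDominating D) where

  -- A fresh edge lies in D or is dominated from D through a shared vertex; either way it avoids g.
  ∃-dominating-edge-avoiding : 2 * suc j ≤ k → (g : Fin j → Edge k) → ∃ λ e → D e × ∀ i → e ≢ g i
  ∃-dominating-edge-avoiding 2j+2≤k g with ∃-edge-avoiding 2j+2≤k g
  ... | e , avoids with D? e
  ...   | yes e∈D = e , e∈D , λ i e≡gi → avoids i (subst (Meet e) e≡gi (meet-self e))
  ...   | no  e∉D with dominating e e∉D
  ...     | f , f∈D , _ , v , v∈e , v∈f =
    f , f∈D , λ i f≡gi → avoids i (v , v∈e , subst (λ g′ → v ∈V proj₁ g′) f≡gi v∈f)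

  distinct-in-dominating : 2 * j ≤ k → Σ (Fin j → Edge k) λ g → Injective _≡_ _≡_ g × ∀ i → D (g i)
  distinct-in-dominating {zero}  _    = (λ ()) , (λ { {()} }) , λ ()
  distinct-in-dominating {suc j} 2j≤k with distinct-in-dominating (≤-trans (*-monoʳ-≤ 2 (n≤1+n j)) 2j≤k)
  ... | g , g-injective , g∈D with ∃-dominating-edge-avoiding 2j≤k g
  ...   | e , e∈D , e∉g = g′ , g′-injective , g′∈D
    where
    g′ : Fin (suc j) → Edge k
    g′ zero    = e
    g′ (suc i) = g i
    g′-injective : Injective _≡_ _≡_ g′
    g′-injective {zero}  {zero}   _  = refl
    g′-injective {zero}  {suc i′} eq = contradiction eq (e∉g i′)
    g′-injective {suc i} {zero}   eq = contradiction (sym eq) (e∉g i)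
    g′-injective {suc i} {suc i′} eq = cong suc (g-injective eq)
    g′∈D : ∀ i → D (g′ i)
    g′∈D zero    = e∈D
    g′∈D (suc i) = g∈D i

domatic-bound : (h : ℕ) {m N : ℕ} → 2 * h ≤ k → EdgeDomaticPartition k m → Edge k ↔ Fin N → m * h ≤ N
domatic-bound {k} h {m} {N} 2h≤k (c , _ , dominating) E↔N =
  injective⇒≤ (Injection.injective (↣-trans (↔⇒↣ *↔×) (↣-trans (mk↣ pick-injective) (↔⇒↣ E↔N))))
  where
  large : (i : Fin m) → Σ (Fin h → Edge k) λ g → Injective _≡_ _≡_ g × ∀ l → c (g l) ≡ i
  large i = distinct-in-dominating (λ e → c e ≟ i) (dominating i) 2h≤k
  pick : Fin m × Fin h → Edge k
  pick (i , l) = proj₁ (large i) l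
  pick-injective : Injective _≡_ _≡_ pick
  pick-injective {i , l} {i′ , l′} eq
    with trans (sym (proj₂ (proj₂ (large i)) l)) (trans (cong c eq) (proj₂ (proj₂ (large i′)) l′))
  ... | refl = cong (i ,_) (proj₁ (proj₂ (large i)) eq)

dominating-nonempty : {m : ℕ} (c : Edge k → Fin m) (i : Fin m) →
                      IsEdgeDominating (λ e → c e ≡ i) → Edge k → ∃ λ e → c e ≡ i
dominating-nonempty c i dominating e with c e ≟ i
... | yes e∈i = e , e∈i
... | no  e∉i = let f , f∈i , _ = dominating e e∉i in f , f∈i

domatic-partition : {m : ℕ} {I : Set} → I ↔ Fin m → Edge k → (c : Edge k → I) →
                    ((i : I) → IsEdgeDominating (λ e → c e ≡ i)) → EdgeDomaticPartition k m
domatic-partition I↔m e₀ c dominating = to ∘ c , surjective , dominating′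
  where
  open Inverse I↔m
  dominating′ : ∀ i → IsEdgeDominating (λ e → to (c e) ≡ i)
  dominating′ i e e∉i =
    let f , f∈i , adjacent = dominating (from i) e (λ e∈i → e∉i (trans (cong to e∈i) (strictlyInverseˡ i)))
    in f , trans (cong to f∈i) (strictlyInverseˡ i) , adjacent
  surjective : Surjective _≡_ _≡_ (to ∘ c)
  surjective i = let e , e∈i = dominating-nonempty (to ∘ c) i (dominating′ i) e₀ in e , λ { refl → e∈i }

module _ {d : ℕ} .{{_ : NonZero d}} where
  open ≡-Reasoning

  [m+n%d]%d≡[m+n]%d : ∀ m n → (m + n % d) % d ≡ (m + n) % d
  [m+n%d]%d≡[m+n]%d m n = begin
    (m + n % d) % d          ≡⟨ %-distribˡ-+ m (n % d) d ⟩
    (m % d + n % d % d) % d  ≡⟨ cong (λ t → (m % d + t) % d) (m%n%n≡m%n n d) ⟩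
    (m % d + n % d) % d      ≡⟨ %-distribˡ-+ m n d ⟨
    (m + n) % d              ∎

  [m*[n%d]]%d≡[m*n]%d : ∀ m n → (m * (n % d)) % d ≡ (m * n) % d
  [m*[n%d]]%d≡[m*n]%d m n = begin
    (m * (n % d)) % d          ≡⟨ %-distribˡ-* m (n % d) d ⟩
    (m % d * (n % d % d)) % d  ≡⟨ cong (λ t → (m % d * t) % d) (m%n%n≡m%n n d) ⟩
    (m % d * (n % d)) % d      ≡⟨ %-distribˡ-* m n d ⟨
    (m * n) % d                ∎

  [m+[r+[d∸m]]%d]%d≡r : ∀ {m r} → m ≤ d → r < d → (m + (r + (d ∸ m)) % d) % d ≡ r
  [m+[r+[d∸m]]%d]%d≡r {m} {r} m≤d r<d = begin
    (m + (r + (d ∸ m)) % d) % d  ≡⟨ [m+n%d]%d≡[m+n]%d m (r + (d ∸ m)) ⟩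
    (m + (r + (d ∸ m))) % d      ≡⟨ cong (_% d) (m+[n+o]≡n+[m+o] m r (d ∸ m)) ⟩
    (r + (m + (d ∸ m))) % d      ≡⟨ cong (λ t → (r + t) % d) (m+[n∸m]≡n m≤d) ⟩
    (r + d) % d                  ≡⟨ [m+n]%n≡m%n r d ⟩
    r % d                        ≡⟨ m<n⇒m%n≡m r<d ⟩
    r                            ∎

  [2*[d+m]]%d≡[2*m]%d : ∀ m → 2 * (d + m) % d ≡ 2 * m % d
  [2*[d+m]]%d≡[2*m]%d m = trans (cong (_% d) (2*[d+m]≡2*m+2*d d m)) ([m+kn]%n≡m%n (2 * m) 2 d)
    where
    2*[d+m]≡2*m+2*d : ∀ d m → 2 * (d + m) ≡ 2 * m + 2 * d
    2*[d+m]≡2*m+2*d = solve-∀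

  -- h is the inverse of 2 modulo d.
  [2*[r*h%d]]%d≡r : ∀ {r h} → 2 * h ≡ suc d → r < d → (2 * (r * h % d)) % d ≡ r
  [2*[r*h%d]]%d≡r {r} {h} 2h≡1+d r<d = begin
    (2 * (r * h % d)) % d  ≡⟨ [m*[n%d]]%d≡[m*n]%d 2 (r * h) ⟩
    (2 * (r * h)) % d      ≡⟨ cong (_% d) (m*[n*o]≡n*[m*o] 2 r h) ⟩
    (r * (2 * h)) % d      ≡⟨ cong (λ t → (r * t) % d) 2h≡1+d ⟩
    (r * suc d) % d        ≡⟨ cong (_% d) (*-suc r d) ⟩
    (r + r * d) % d        ≡⟨ [m+kn]%n≡m%n r r d ⟩
    r % d                  ≡⟨ m<n⇒m%n≡m r<d ⟩
    r                      ∎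
    where
    m*[n*o]≡n*[m*o] : ∀ m n o → m * (n * o) ≡ n * (m * o)
    m*[n*o]≡n*[m*o] = solve-∀

-- The round-robin partition

module RoundRobin (n h : ℕ) {{_ : NonZero n}} (1+n≡2h : suc n ≡ 2 * h) where
  open ≡-Reasoning

  ∞ : Fin (suc n)
  ∞ = fromℕ n

  -- The round-robin 1-factorisation of the complete graph on Fin n ∪ {∞}: {a, b} gets colour
  -- a + b and {x, ∞} gets colour 2x, modulo n. The element sum of {x, ∞} is x + n.
  colourSum : Vec Bool (suc n) → ℕ
  colourSum v = if lookup v ∞ then 2 * elementSum v else elementSum v

  colour : Vec Bool (suc n) → Fin n
  colour v = colourSum v mod n

  colour-≡ : (v : Vec Bool (suc n)) {r : Fin n} → colourSum v % n ≡ toℕ r → colour v ≡ r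
  colour-≡ _ eq = toℕ-injective (trans (toℕ-fromℕ< _) eq)

  colourSum-∞ : (y : Fin n) → colourSum (pair ∞ (inject₁ y)) ≡ 2 * (n + toℕ y)
  colourSum-∞ y rewrite lookup-pairˡ ∞ (inject₁ y) =
    cong (2 *_) (trans (elementSum-pair (fromℕ≢inject₁ {i = y})) (cong₂ _+_ (toℕ-fromℕ n) (toℕ-inject₁ y)))

  colourSum-inject₁ : {x y : Fin n} → x ≢ y → colourSum (pair (inject₁ x) (inject₁ y)) ≡ toℕ x + toℕ y
  colourSum-inject₁ {x} {y} x≢y
    rewrite lookup-pair-≢ {a = inject₁ x} {inject₁ y} fromℕ≢inject₁ fromℕ≢inject₁ =
    trans (elementSum-pair (x≢y ∘ inject₁-injective)) (cong₂ _+_ (toℕ-inject₁ x) (toℕ-inject₁ y))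

  -- r − x modulo n, without truncated subtraction.
  mate : Fin n → Fin n → Fin n
  mate r x = (toℕ r + (n ∸ toℕ x)) mod n

  x+mate≡r : (r x : Fin n) → (toℕ x + toℕ (mate r x)) % n ≡ toℕ r
  x+mate≡r r x rewrite toℕ-fromℕ< (m%n<n (toℕ r + (n ∸ toℕ x)) n) =
    [m+[r+[d∸m]]%d]%d≡r (<⇒≤ (toℕ<n x)) (toℕ<n r)

  partner-∞ : (r : Fin n) → ∃ λ p → ∞ ≢ p × colour (pair ∞ p) ≡ r
  partner-∞ r = inject₁ y , fromℕ≢inject₁ , colour-≡ (pair ∞ (inject₁ y)) (begin
    colourSum (pair ∞ (inject₁ y)) % n  ≡⟨ cong (_% n) (colourSum-∞ y) ⟩
    2 * (n + toℕ y) % n                 ≡⟨ [2*[d+m]]%d≡[2*m]%d (toℕ y) ⟩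
    2 * toℕ y % n                       ≡⟨ cong (λ t → 2 * t % n) (toℕ-fromℕ< (m%n<n (toℕ r * h) n)) ⟩
    2 * (toℕ r * h % n) % n             ≡⟨ [2*[r*h%d]]%d≡r (sym 1+n≡2h) (toℕ<n r) ⟩
    toℕ r                               ∎)
    where
    y = (toℕ r * h) mod n

  partner-inject₁ : (r x : Fin n) → ∃ λ p → inject₁ x ≢ p × colour (pair (inject₁ x) p) ≡ r
  partner-inject₁ r x with mate r x ≟ x
  ... | yes mate≡x = ∞ , (λ x≡∞ → fromℕ≢inject₁ (sym x≡∞)) , colour-≡ (pair (inject₁ x) ∞) (begin
    colourSum (pair (inject₁ x) ∞) % n  ≡⟨ cong (λ v → colourSum v % n) (∪-comm ⁅ inject₁ x ⁆ ⁅ ∞ ⁆) ⟩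
    colourSum (pair ∞ (inject₁ x)) % n  ≡⟨ cong (_% n) (colourSum-∞ x) ⟩
    2 * (n + toℕ x) % n                 ≡⟨ [2*[d+m]]%d≡[2*m]%d (toℕ x) ⟩
    (toℕ x + (toℕ x + 0)) % n           ≡⟨ cong (λ t → (toℕ x + t) % n) (+-identityʳ (toℕ x)) ⟩
    (toℕ x + toℕ x) % n                 ≡⟨ cong (λ t → (toℕ x + toℕ t) % n) (sym mate≡x) ⟩
    (toℕ x + toℕ (mate r x)) % n        ≡⟨ x+mate≡r r x ⟩
    toℕ r                               ∎)
  ... | no mate≢x = inject₁ (mate r x) , mate≢x ∘ sym ∘ inject₁-injective ,
    colour-≡ (pair (inject₁ x) (inject₁ (mate r x))) (begin
    colourSum (pair (inject₁ x) (inject₁ (mate r x))) % n  ≡⟨ cong (_% n) (colourSum-inject₁ (mate≢x ∘ sym)) ⟩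
    (toℕ x + toℕ (mate r x)) % n                          ≡⟨ x+mate≡r r x ⟩
    toℕ r                                                 ∎)

  -- Every colour class is a perfect matching; only the fact that it covers every vertex is needed.
  partner : (r : Fin n) (x : Fin (suc n)) → ∃ λ p → x ≢ p × colour (pair x p) ≡ r
  partner r x with view x
  ... | ‵fromℕ     = partner-∞ r
  ... | ‵inject₁ y = partner-inject₁ r y

  Class : Set
  Class = (Fin 2 × Fin n) × Fin (suc n)

  point : Vec Bool (suc n) → Fin (suc n)
  point v = elementSum v mod suc n

  point-⁅⁆ : (y : Fin (suc n)) → point ⁅ y ⁆ ≡ y
  point-⁅⁆ y = toℕ-injective (begin
    toℕ (point ⁅ y ⁆)         ≡⟨ toℕ-fromℕ< (m%n<n (elementSum ⁅ y ⁆) (suc n)) ⟩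
    elementSum ⁅ y ⁆ % suc n  ≡⟨ cong (_% suc n) (elementSum-⁅⁆ y) ⟩
    toℕ y % suc n             ≡⟨ m<n⇒m%n≡m (toℕ<n y) ⟩
    toℕ y                     ∎)

  classOf : ℕ → Vec Bool (suc n) → Vec Bool (suc n) → Class
  classOf 2 sX sY = (zero     , colour sX) , point sY
  classOf _ sX sY = (suc zero , colour sY) , point sX

  class : Edge (suc n) → Class
  class e = classOf (ones (edgeX e)) (edgeX e) (edgeY e)

  class-edge₂₁ : {x p : Fin (suc n)} (x≢p : x ≢ p) (y : Fin (suc n)) →
                 class (edge₂₁ x≢p y) ≡ ((zero , colour (pair x p)) , y)
  class-edge₂₁ {x} {p} x≢p y =
    trans (cong (λ t → classOf t (pair x p) ⁅ y ⁆) (ones-pair x≢p)) (cong (_ ,_) (point-⁅⁆ y))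

  class-edge₁₂ : {x p : Fin (suc n)} (y : Fin (suc n)) (x≢p : x ≢ p) →
                 class (edge₁₂ y x≢p) ≡ ((suc zero , colour (pair x p)) , y)
  class-edge₁₂ {x} {p} y x≢p =
    trans (cong (λ t → classOf t ⁅ y ⁆ (pair x p)) (ones-⁅⁆ y)) (cong (_ ,_) (point-⁅⁆ y))

  -- For i = ((side, r), y): a vertex x of e on that side, its partner p in colour r, and y
  -- form an edge of class i meeting e in x.
  class-dominating : (i : Class) → IsEdgeDominating (λ e → class e ≡ i)
  class-dominating i@((zero , r) , y) e@((sX , sY) , t) e∉i
    with anyB⇒∃ sX (proj₁ (proj₂ (isEdge⁻ sX sY t)))
  ... | x , x∈e with partner r x
  ... | p , x≢p , colour≡r = edge₂₁ x≢p y , f∈i , (λ e≡f → e∉i (trans (cong class e≡f) f∈i)) ,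
                             inj₁ x , x∈e , lookup-pairˡ x p
    where
    f∈i : class (edge₂₁ x≢p y) ≡ i
    f∈i = trans (class-edge₂₁ x≢p y) (cong (λ c → (zero , c) , y) colour≡r)
  class-dominating i@((suc zero , r) , y) e@((sX , sY) , t) e∉i
    with anyB⇒∃ sY (proj₂ (proj₂ (isEdge⁻ sX sY t)))
  ... | x , x∈e with partner r x
  ... | p , x≢p , colour≡r = edge₁₂ y x≢p , f∈i , (λ e≡f → e∉i (trans (cong class e≡f) f∈i)) ,
                             inj₂ x , x∈e , lookup-pairˡ x p
    where
    f∈i : class (edge₁₂ y x≢p) ≡ i
    f∈i = trans (class-edge₁₂ y x≢p) (cong (λ c → (suc zero , c) , y) colour≡r)

  roundRobin : EdgeDomaticPartition (suc n) (2 * n * suc n)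
  roundRobin = domatic-partition Class↔ (edge₂₁ (fromℕ≢inject₁ {i = i₀}) ∞) class class-dominating
    where
    i₀ : Fin n
    i₀ = fromℕ< (>-nonZero⁻¹ n)
    Class↔ : Class ↔ Fin (2 * n * suc n)
    Class↔ = ↔-sym (↔-trans *↔× (*↔× ×-↔ ↔-refl))

-- Counting edges

Combination : ℕ → ℕ → Set
Combination m j = Σ (Vec Bool m) λ v → ones v ≡ j

combination-≡ : {u v : Combination m j} → proj₁ u ≡ proj₁ v → u ≡ v
combination-≡ {u = v , p} {.v , q} refl = cong (v ,_) (≡-irrelevant p q)

ones≡0⇒∅ : (v : Vec Bool m) → ones v ≡ 0 → v ≡ ∅
ones≡0⇒∅ []          _  = refl
ones≡0⇒∅ (false ∷ v) eq = cong (false ∷_) (ones≡0⇒∅ v eq)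

uncons↣ : Combination (suc m) (suc j) ↣ (Combination m j ⊎ Combination m (suc j))
uncons↣ {m} {j} = mk↣ uncons-injective
  where
  uncons : Combination (suc m) (suc j) → Combination m j ⊎ Combination m (suc j)
  uncons (true  ∷ v , p) = inj₁ (v , suc-injective p)
  uncons (false ∷ v , p) = inj₂ (v , p)
  uncons-injective : Injective _≡_ _≡_ uncons
  uncons-injective {true  ∷ _ , _} {true  ∷ _ , _} eq =
    combination-≡ (cong ((true ∷_) ∘ proj₁) (inj₁-injective eq))
  uncons-injective {false ∷ _ , _} {false ∷ _ , _} eq =
    combination-≡ (cong ((false ∷_) ∘ proj₁) (inj₂-injective eq))
  uncons-injective {true  ∷ _ , _} {false ∷ _ , _} ()
  uncons-injective {false ∷ _ , _} {true  ∷ _ , _} ()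

combination↣ : ∀ m j → Combination m j ↣ Fin (m C j)
combination↣ m       zero    = mk↣ {to = λ _ → zero} λ { {u , u₀} {v , v₀} _ →
  combination-≡ (trans (ones≡0⇒∅ u u₀) (sym (ones≡0⇒∅ v v₀))) }
combination↣ zero    (suc j) = mk↣ {to = λ { ([] , ()) }} λ { {[] , ()} }
combination↣ (suc m) (suc j) =
  subst (λ c → Combination (suc m) (suc j) ↣ Fin c) (nCk+nC[k+1]≡[n+1]C[k+1] m j)
    (↣-trans uncons↣ (↣-trans (combination↣ m j ⊎-↣ combination↣ m (suc j)) (↔⇒↣ (↔-sym +↔⊎))))

EdgeCode : ℕ → Set
EdgeCode k = (Combination k 2 × Combination k 1) ⊎ (Combination k 1 × Combination k 2)

edge↣ : Edge k ↣ EdgeCode k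
edge↣ {k} = mk↣ {to = λ e → encode (proj₁ e) (edge-shape e)} λ {e} {f} eq →
  Edge-≡ e f (trans (sym (decode-encode _ (edge-shape e)))
                    (trans (cong decode eq) (decode-encode _ (edge-shape f))))
  where
  encode : (s : VSubset k) → Shape (ones (proj₁ s)) (ones (proj₂ s)) → EdgeCode k
  encode (sX , sY) (inj₁ (x≡2 , y≡1)) = inj₁ ((sX , x≡2) , (sY , y≡1))
  encode (sX , sY) (inj₂ (x≡1 , y≡2)) = inj₂ ((sX , x≡1) , (sY , y≡2))
  decode : EdgeCode k → VSubset k
  decode (inj₁ ((sX , _) , (sY , _))) = sX , sY
  decode (inj₂ ((sX , _) , (sY , _))) = sX , sY
  decode-encode : (s : VSubset k) (σ : Shape (ones (proj₁ s)) (ones (proj₂ s))) → decode (encode s σ) ≡ s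
  decode-encode _ (inj₁ _) = refl
  decode-encode _ (inj₂ _) = refl

edge-count : {N : ℕ} → Edge k ↔ Fin N → N ≤ (k C 2) * (k C 1) + (k C 1) * (k C 2)
edge-count {k} E↔N = injective⇒≤ (Injection.injective
  (↣-trans (↔⇒↣ (↔-sym E↔N)) (↣-trans edge↣ (↣-trans
    ((combination↣ k 2 ×-↣ combination↣ k 1) ⊎-↣ (combination↣ k 1 ×-↣ combination↣ k 2))
    (↣-trans (↔⇒↣ (↔-sym *↔×) ⊎-↣ ↔⇒↣ (↔-sym *↔×)) (↔⇒↣ (↔-sym +↔⊎)))))))

2*[1+n]C2≡[1+n]*n : ∀ n → 2 * (suc n C 2) ≡ suc n * n
2*[1+n]C2≡[1+n]*n zero    = refl
2*[1+n]C2≡[1+n]*n (suc n) = begin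
  2 * (suc (suc n) C 2)             ≡⟨ cong (2 *_) (nCk+nC[k+1]≡[n+1]C[k+1] (suc n) 1) ⟨
  2 * (suc n C 1 + suc n C 2)       ≡⟨ cong (λ c → 2 * (c + suc n C 2)) (nC1≡n (suc n)) ⟩
  2 * (suc n + suc n C 2)           ≡⟨ *-distribˡ-+ 2 (suc n) (suc n C 2) ⟩
  2 * suc n + 2 * (suc n C 2)       ≡⟨ cong (2 * suc n +_) (2*[1+n]C2≡[1+n]*n n) ⟩
  2 * suc n + suc n * n             ≡⟨ 2*[1+n]+[1+n]*n≡[2+n]*[1+n] n ⟩
  suc (suc n) * suc n               ∎
  where
  open ≡-Reasoning
  2*[1+n]+[1+n]*n≡[2+n]*[1+n] : ∀ n → 2 * suc n + suc n * n ≡ suc (suc n) * suc n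
  2*[1+n]+[1+n]*n≡[2+n]*[1+n] = solve-∀

edge-total : ∀ n h → suc n ≡ 2 * h →
             (suc n C 2) * (suc n C 1) + (suc n C 1) * (suc n C 2) ≡ 2 * n * suc n * h
edge-total n h 1+n≡2h = begin
  c * (suc n C 1) + (suc n C 1) * c  ≡⟨ cong₂ (λ a b → c * a + b * c) (nC1≡n (suc n)) (nC1≡n (suc n)) ⟩
  c * suc n + suc n * c              ≡⟨ c*k+k*c≡2*c*k c (suc n) ⟩
  2 * c * suc n                      ≡⟨ cong (_* suc n) (2*[1+n]C2≡[1+n]*n n) ⟩
  suc n * n * suc n                  ≡⟨ cong (suc n * n *_) 1+n≡2h ⟩
  suc n * n * (2 * h)                ≡⟨ k*n*[2*h]≡2*n*k*h (suc n) n h ⟩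
  2 * n * suc n * h                  ∎
  where
  open ≡-Reasoning
  c = suc n C 2
  c*k+k*c≡2*c*k : ∀ c k → c * k + k * c ≡ 2 * c * k
  c*k+k*c≡2*c*k = solve-∀
  k*n*[2*h]≡2*n*k*h : ∀ k n h → k * n * (2 * h) ≡ 2 * n * k * h
  k*n*[2*h]≡2*n*k*h = solve-∀

lemma6 : (k h : ℕ) → .{{_ : NonZero h}} → k ≡ 2 * h →
           (N : ℕ) → (Edge k ↔ Fin N) →
           EdgeDomaticNumber k (N / h)
lemma6 zero            h 0≡2h _ _ = contradiction (sym 0≡2h) (≢-nonZero⁻¹ (2 * h) {{m*n≢0 2 h}})
lemma6 (suc zero)      h 1≡2h _ _ = contradiction (sym 1≡2h) (even≢odd h 0)
lemma6 (suc n@(suc _)) h k≡2h N E↔N =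
  subst (EdgeDomaticPartition (suc n)) (sym N/h≡M) roundRobin , maximal
  where
  open RoundRobin n h k≡2h using (roundRobin)
  M = 2 * n * suc n
  N≡M*h : N ≡ M * h
  N≡M*h = ≤-antisym (≤-trans (edge-count E↔N) (≤-reflexive (edge-total n h k≡2h)))
                    (domatic-bound h (≤-reflexive (sym k≡2h)) roundRobin E↔N)
  N/h≡M : N / h ≡ M
  N/h≡M = trans (cong (_/ h) N≡M*h) (m*n/n≡m M h)
  maximal : (m : ℕ) → EdgeDomaticPartition (suc n) m → m ≤ N / h
  maximal m P = subst (m ≤_) (sym N/h≡M)
    (*-cancelʳ-≤ m M h (subst (m * h ≤_) N≡M*h (domatic-bound h (≤-reflexive (sym k≡2h)) P E↔N)))
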